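{- Let $\Gamma\cup\{\alpha\}$ be a finite set of formulas of classical propositional logic $\mathbf{CPL}$ (formulas built from propositional variables with $\wedge,\vee,\neg$ only), and let $\{p_1,\dots,p_n\}$ be the set of propositional variables occurring in $\Gamma\cup\{\alpha\}$. Then $\Gamma\vdash_{\mathbf{CPL}}\alpha$ if and only if $\Gamma,\circ p_1,\dots,\circ p_n\models_{\mathbf{Six}}\alpha$, where $\circ p=\neg\nabla\neg p\vee\neg\nabla\neg\neg p$.
   Context: An involutive Stone algebra is a De Morgan algebra (bounded distributive lattice with $\neg\neg x=x$, $\neg(x\wedge y)=\neg x\vee\neg y$) with a unary $\nabla$ satisfying $\nabla0=0$, $a\wedge\nabla a=a$, $\nabla(a\wedge b)=\nabla a\wedge\nabla b$, $\neg\nabla a\wedge\nabla a=0$; the class is $\mathbf S$. $Fm$ is the set of formulas over a denumerable set of propositional variables built from binary $\wedge,\vee$, unary $\neg,\nabla$ and constants $\bot,\top$; homomorphisms send $\bot\mapsto0,\top\mapsto1$. The logic $\mathbf{Six}$: for nonempty finite premises, $\alpha_1,\dots,\alpha_n\models_{\mathbf{Six}}\alpha$ iff for every $A\in\mathbf S$, every homomorphism $v:\mathfrak{Fm}\to A$ and every $a\in A$, if $v(\alpha_i)\ge a$ for all $i$ then $v(\alpha)\ge a$. $\vdash_{\mathbf{CPL}}$ is classical (two-valued) consequence. -}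

module Defs where

open import Data.Nat using (ℕ)
open import Data.Bool using (Bool; true; false; _∧_; _∨_; not)
open import Data.List using (List; []; _∷_; _++_; map)
open import Data.List.Relation.Unary.All using (All)
open import Relation.Binary.PropositionalEquality using (_≡_)
open import Data.Product using (_×_)
open import Function using (_⇔_)

data Fm : Set where
  var  : ℕ → Fm
  _∧f_ : Fm → Fm → Fm
  _∨f_ : Fm → Fm → Fm
  ¬f_  : Fm → Fm
  ∇f_  : Fm → Fm
  ⊥f   : Fm
  ⊤f   : Fm

data IsCPL : Fm → Set where
  var : ∀ n → IsCPL (var n)
  and : ∀ {a b} → IsCPL a → IsCPL b → IsCPL (a ∧f b)
  or  : ∀ {a b} → IsCPL a → IsCPL b → IsCPL (a ∨f b)
  neg : ∀ {a} → IsCPL a → IsCPL (¬f a)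

vars : Fm → List ℕ
vars (var n)  = n ∷ []
vars (a ∧f b) = vars a ++ vars b
vars (a ∨f b) = vars a ++ vars b
vars (¬f a)   = vars a
vars (∇f a)   = vars a
vars ⊥f       = []
vars ⊤f       = []

varsList : List Fm → List ℕ
varsList []       = []
varsList (a ∷ as) = vars a ++ varsList as

∘_ : Fm → Fm
∘ p = (¬f (∇f (¬f p))) ∨f (¬f (∇f (¬f (¬f p))))

evalB : (ℕ → Bool) → Fm → Bool
evalB v (var n)  = v n
evalB v (a ∧f b) = evalB v a ∧ evalB v b
evalB v (a ∨f b) = evalB v a ∨ evalB v b
evalB v (¬f a)   = not (evalB v a)
evalB v (∇f a)   = evalB v a   -- never used on CPL formulas
evalB v ⊥f       = false
evalB v ⊤f       = true

infix 4 _⊢CPL_ _⊨Six_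
_⊢CPL_ : List Fm → Fm → Set
Γ ⊢CPL α = (v : ℕ → Bool) → All (λ γ → evalB v γ ≡ true) Γ → evalB v α ≡ true

record InvStoneAlgebra : Set₁ where
  infixr 7 _⊓_
  infixr 6 _⊔_
  field
    Carrier : Set
    _⊓_ _⊔_ : Carrier → Carrier → Carrier
    ~_ ∇_   : Carrier → Carrier
    𝟘 𝟙     : Carrier
    ⊓-assoc : ∀ x y z → (x ⊓ y) ⊓ z ≡ x ⊓ (y ⊓ z)
    ⊔-assoc : ∀ x y z → (x ⊔ y) ⊔ z ≡ x ⊔ (y ⊔ z)
    ⊓-comm  : ∀ x y → x ⊓ y ≡ y ⊓ x
    ⊔-comm  : ∀ x y → x ⊔ y ≡ y ⊔ x
    ⊓-absorb : ∀ x y → x ⊓ (x ⊔ y) ≡ x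
    ⊔-absorb : ∀ x y → x ⊔ (x ⊓ y) ≡ x
    ⊓-distrib : ∀ x y z → x ⊓ (y ⊔ z) ≡ (x ⊓ y) ⊔ (x ⊓ z)
    ⊓-𝟙 : ∀ x → x ⊓ 𝟙 ≡ x
    ⊔-𝟘 : ∀ x → x ⊔ 𝟘 ≡ x
    ~~ : ∀ x → ~ (~ x) ≡ x
    ~-⊓ : ∀ x y → ~ (x ⊓ y) ≡ (~ x) ⊔ (~ y)
    ∇𝟘 : ∇ 𝟘 ≡ 𝟘
    ∇-incr : ∀ a → a ⊓ (∇ a) ≡ a
    ∇-⊓ : ∀ a b → ∇ (a ⊓ b) ≡ (∇ a) ⊓ (∇ b)
    ∇-compl : ∀ a → (~ (∇ a)) ⊓ (∇ a) ≡ 𝟘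

  _≤_ : Carrier → Carrier → Set
  x ≤ y = x ⊓ y ≡ x

  record IsHom (h : Fm → Carrier) : Set where
    field
      hom-∧ : ∀ a b → h (a ∧f b) ≡ h a ⊓ h b
      hom-∨ : ∀ a b → h (a ∨f b) ≡ h a ⊔ h b
      hom-¬ : ∀ a → h (¬f a) ≡ ~ (h a)
      hom-∇ : ∀ a → h (∇f a) ≡ ∇ (h a)
      hom-⊥ : h ⊥f ≡ 𝟘
      hom-⊤ : h ⊤f ≡ 𝟙

-- The logic Six (premises given as a list, read as a finite set)

_⊨Six_ : List Fm → Fm → Set₁
Γ ⊨Six α = (A : InvStoneAlgebra) → let open InvStoneAlgebra A in
  (h : Fm → Carrier) → IsHom h → (a : Carrier) →
  All (λ γ → a ≤ h γ) Γ → a ≤ h α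

{-# OPTIONS --safe #-}
-- Write Δ y = ¬∇¬y, the part of y on which y is classically true: Δ y ≤ y and Δ y ∧ ¬y = 0.
-- Then ∘p = Δ p ∨ Δ ¬p, so below the premises ∘p₁, …, ∘pₙ the element a splits, by
-- distributivity, into pieces indexed by the classical valuations of p₁, …, pₙ. On the piece of
-- a valuation v every CPL formula is forced to its truth value under v, hence the piece is 0
-- if v falsifies a premise in Γ and lies below α otherwise. Conversely, every valuation is a
-- homomorphism into the two-element involutive Stone algebra, where each ∘p evaluates to 1.
module Submission where

open import Defs
open import Algebra.Lattice.Bundles using (Lattice)
import Algebra.Lattice.Properties.Lattice as LatticeProperties
import Relation.Binary.Lattice as Order
open import Data.Bool using (Bool; true; false; not; if_then_else_)
  renaming (_∧_ to _∧ᵇ_; _∨_ to _∨ᵇ_)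
import Data.Bool.Properties as Bool
open import Data.List using (List; []; _∷_; _++_; map)
open import Data.List.Relation.Unary.All using (All; []; _∷_)
import Data.List.Relation.Unary.All as All
open import Data.List.Relation.Unary.All.Properties using (++⁺; ++⁻ˡ; ++⁻ʳ; map⁺; map⁻)
open import Data.List.Relation.Unary.Any using (here; there; tail)
open import Data.List.Membership.Propositional using (_∈_)
open import Data.List.Membership.Propositional.Properties using (∈-++⁺ˡ; ∈-++⁺ʳ)
open import Data.Nat using (ℕ; _≟_)
open import Data.Product using (_×_; _,_)
open import Data.Sum using (_⊎_; inj₁; inj₂)
import Data.Sum as Sum
open import Relation.Nullary using (yes; no)
open import Relation.Binary.PropositionalEquality
  using (_≡_; refl; sym; trans; cong; cong₂; subst; isEquivalence; module ≡-Reasoning)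

_[_≔_] : (ℕ → Bool) → ℕ → Bool → ℕ → Bool
(v [ q ≔ b ]) p with p ≟ q
... | yes _ = b
... | no _  = v p

module InvStoneAlgebraProperties (A : InvStoneAlgebra) where
  open InvStoneAlgebra A hiding (_≤_)
  open ≡-Reasoning

  lattice : Lattice _ _
  lattice = record
    { Carrier   = Carrier
    ; _≈_       = _≡_
    ; _∨_       = _⊔_
    ; _∧_       = _⊓_
    ; isLattice = record
      { isEquivalence = isEquivalence
      ; ∨-comm        = ⊔-comm
      ; ∨-assoc       = ⊔-assoc
      ; ∨-cong        = cong₂ _⊔_
      ; ∧-comm        = ⊓-comm
      ; ∧-assoc       = ⊓-assoc
      ; ∧-cong        = cong₂ _⊓_
      ; absorptive    = ⊔-absorb , ⊓-absorb
      }
    }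

  -- Here x ≤ y unfolds to x ≡ x ⊓ y, the symmetric form of the order used in Defs.
  open Order.Lattice (LatticeProperties.∨-∧-orderTheoreticLattice lattice)
    using (_≤_; reflexive; x≤x∨y; ∨-least; x∧y≤x; x∧y≤y; ∧-greatest)
    renaming (refl to ≤-refl; trans to ≤-trans)

  ⊓-zeroˡ : ∀ x → 𝟘 ⊓ x ≡ 𝟘
  ⊓-zeroˡ x = begin
    𝟘 ⊓ x        ≡⟨ cong (𝟘 ⊓_) (trans (⊔-comm 𝟘 x) (⊔-𝟘 x)) ⟨
    𝟘 ⊓ (𝟘 ⊔ x)  ≡⟨ ⊓-absorb 𝟘 x ⟩
    𝟘            ∎

  ⊓-zeroʳ : ∀ x → x ⊓ 𝟘 ≡ 𝟘
  ⊓-zeroʳ x = trans (⊓-comm x 𝟘) (⊓-zeroˡ x)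

  𝟘-minimum : ∀ x → 𝟘 ≤ x
  𝟘-minimum x = sym (⊓-zeroˡ x)

  ≡𝟘⇒≤ : ∀ {x t} → x ≡ 𝟘 → x ≤ t
  ≡𝟘⇒≤ {t = t} refl = 𝟘-minimum t

  ≤-⊔-split : ∀ {a y z} → a ≤ y ⊔ z → a ≤ (a ⊓ y) ⊔ (a ⊓ z)
  ≤-⊔-split {a} {y} {z} a≤y⊔z = reflexive (trans a≤y⊔z (⊓-distrib a y z))

  ⊓≡𝟘-antitoneˡ : ∀ {x′ x z} → x′ ≤ x → x ⊓ z ≡ 𝟘 → x′ ⊓ z ≡ 𝟘
  ⊓≡𝟘-antitoneˡ {x′} {x} {z} x′≤x x⊓z≡𝟘 = begin
    x′ ⊓ z        ≡⟨ cong (_⊓ z) x′≤x ⟩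
    (x′ ⊓ x) ⊓ z  ≡⟨ ⊓-assoc x′ x z ⟩
    x′ ⊓ (x ⊓ z)  ≡⟨ cong (x′ ⊓_) x⊓z≡𝟘 ⟩
    x′ ⊓ 𝟘        ≡⟨ ⊓-zeroʳ x′ ⟩
    𝟘             ∎

  ~-⊔ : ∀ x y → ~ (x ⊔ y) ≡ ~ x ⊓ ~ y
  ~-⊔ x y = begin
    ~ (x ⊔ y)          ≡⟨ cong₂ (λ u w → ~ (u ⊔ w)) (~~ x) (~~ y) ⟨
    ~ (~ ~ x ⊔ ~ ~ y)  ≡⟨ cong ~_ (~-⊓ (~ x) (~ y)) ⟨
    ~ ~ (~ x ⊓ ~ y)    ≡⟨ ~~ (~ x ⊓ ~ y) ⟩
    ~ x ⊓ ~ y          ∎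

  ~-antitone : ∀ {x y} → x ≤ y → ~ y ≤ ~ x
  ~-antitone {x} {y} x≤y = begin
    ~ y              ≡⟨ cong ~_ (⊔-absorb y x) ⟨
    ~ (y ⊔ (y ⊓ x))  ≡⟨ cong (λ z → ~ (y ⊔ z)) (trans (⊓-comm y x) (sym x≤y)) ⟩
    ~ (y ⊔ x)        ≡⟨ ~-⊔ y x ⟩
    ~ y ⊓ ~ x        ∎

  -- x ⊩ y: below x, the element y behaves like the classical value true.
  infix 4 _⊩_
  _⊩_ : Carrier → Carrier → Set
  x ⊩ y = x ≤ y × x ⊓ ~ y ≡ 𝟘

  ⊩-antitone : ∀ {x′ x y} → x′ ≤ x → x ⊩ y → x′ ⊩ y
  ⊩-antitone x′≤x (x≤y , x⊓~y≡𝟘) = ≤-trans x′≤x x≤y , ⊓≡𝟘-antitoneˡ x′≤x x⊓~y≡𝟘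

  ⊩-⊓ : ∀ {x y z} → x ⊩ y → x ⊩ z → x ⊩ y ⊓ z
  ⊩-⊓ {x} {y} {z} (x≤y , x⊓~y≡𝟘) (x≤z , x⊓~z≡𝟘) = ∧-greatest x≤y x≤z , (begin
    x ⊓ ~ (y ⊓ z)              ≡⟨ cong (x ⊓_) (~-⊓ y z) ⟩
    x ⊓ (~ y ⊔ ~ z)            ≡⟨ ⊓-distrib x (~ y) (~ z) ⟩
    (x ⊓ ~ y) ⊔ (x ⊓ ~ z)      ≡⟨ cong₂ _⊔_ x⊓~y≡𝟘 x⊓~z≡𝟘 ⟩
    𝟘 ⊔ 𝟘                      ≡⟨ ⊔-𝟘 𝟘 ⟩
    𝟘                          ∎)

  ⊩-⊔ˡ : ∀ {x y z} → x ⊩ y → x ⊩ y ⊔ z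
  ⊩-⊔ˡ {x} {y} {z} (x≤y , x⊓~y≡𝟘) = ≤-trans x≤y (x≤x∨y y z) , (begin
    x ⊓ ~ (y ⊔ z)      ≡⟨ cong (x ⊓_) (~-⊔ y z) ⟩
    x ⊓ (~ y ⊓ ~ z)    ≡⟨ ⊓-assoc x (~ y) (~ z) ⟨
    (x ⊓ ~ y) ⊓ ~ z    ≡⟨ cong (_⊓ ~ z) x⊓~y≡𝟘 ⟩
    𝟘 ⊓ ~ z            ≡⟨ ⊓-zeroˡ (~ z) ⟩
    𝟘                  ∎)

  ⊩-⊔ʳ : ∀ {x y z} → x ⊩ z → x ⊩ y ⊔ z
  ⊩-⊔ʳ {x} {y} {z} x⊩z = subst (x ⊩_) (⊔-comm z y) (⊩-⊔ˡ x⊩z)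

  ⊩-~~ : ∀ {x y} → x ⊩ y → x ⊩ ~ ~ y
  ⊩-~~ {x} {y} = subst (x ⊩_) (sym (~~ y))

  ⊩-contradiction : ∀ {x y} → x ⊩ ~ y → x ≤ y → x ≡ 𝟘
  ⊩-contradiction {x} {y} (_ , x⊓~~y≡𝟘) x≤y = begin
    x          ≡⟨ x≤y ⟩
    x ⊓ y      ≡⟨ cong (x ⊓_) (~~ y) ⟨
    x ⊓ ~ ~ y  ≡⟨ x⊓~~y≡𝟘 ⟩
    𝟘          ∎

  Δ : Carrier → Carrier
  Δ y = ~ ∇ ~ y

  Δ-⊩ : ∀ y → Δ y ⊩ y
  Δ-⊩ y = subst (Δ y ≤_) (~~ y) (~-antitone ~y≤∇~y) ,
          trans (⊓-comm (Δ y) (~ y)) (⊓≡𝟘-antitoneˡ ~y≤∇~y ∇~y⊓Δy≡𝟘)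
    where
      ~y≤∇~y : ~ y ≤ ∇ ~ y
      ~y≤∇~y = sym (∇-incr (~ y))
      ∇~y⊓Δy≡𝟘 : ∇ ~ y ⊓ Δ y ≡ 𝟘
      ∇~y⊓Δy≡𝟘 = trans (⊓-comm (∇ ~ y) (Δ y)) (∇-compl (~ y))

  signed : Bool → Carrier → Carrier
  signed b y = if b then y else ~ y

  ⊩-signed-∧ : ∀ {x y z} b c → x ⊩ signed b y → x ⊩ signed c z → x ⊩ signed (b ∧ᵇ c) (y ⊓ z)
  ⊩-signed-∧             true  true  x⊩y  x⊩z  = ⊩-⊓ x⊩y x⊩z
  ⊩-signed-∧ {x} {y} {z} true  false _    x⊩~z = subst (x ⊩_) (sym (~-⊓ y z)) (⊩-⊔ʳ x⊩~z)
  ⊩-signed-∧ {x} {y} {z} false _     x⊩~y _    = subst (x ⊩_) (sym (~-⊓ y z)) (⊩-⊔ˡ x⊩~y)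

  ⊩-signed-∨ : ∀ {x y z} b c → x ⊩ signed b y → x ⊩ signed c z → x ⊩ signed (b ∨ᵇ c) (y ⊔ z)
  ⊩-signed-∨             true  _     x⊩y  _    = ⊩-⊔ˡ x⊩y
  ⊩-signed-∨             false true  _    x⊩z  = ⊩-⊔ʳ x⊩z
  ⊩-signed-∨ {x} {y} {z} false false x⊩~y x⊩~z = subst (x ⊩_) (sym (~-⊔ y z)) (⊩-⊓ x⊩~y x⊩~z)

  ⊩-signed-not : ∀ {x y} b → x ⊩ signed b y → x ⊩ signed (not b) (~ y)
  ⊩-signed-not true  x⊩y  = ⊩-~~ x⊩y
  ⊩-signed-not false x⊩~y = x⊩~y

  ⊩-signed-true : ∀ {x y b} → b ≡ true → x ⊩ signed b y → x ≤ y
  ⊩-signed-true refl (x≤y , _) = x≤y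

  ⊩-signed-≤ : ∀ {x y} b → x ⊩ signed b y → x ≤ y → b ≡ true ⊎ x ≡ 𝟘
  ⊩-signed-≤ true  _    _   = inj₁ refl
  ⊩-signed-≤ false x⊩~y x≤y = inj₂ (⊩-contradiction x⊩~y x≤y)

  split-by-valuations : (lit : ℕ → Bool → Carrier) (ps : List ℕ) {a t : Carrier} →
    (∀ {p} → p ∈ ps → a ≤ lit p true ⊔ lit p false) →
    (∀ {x} v → x ≤ a → (∀ {p} → p ∈ ps → x ≤ lit p (v p)) → x ≤ t) →
    a ≤ t
  split-by-valuations lit []       covered below-t = below-t (λ _ → true) ≤-refl (λ ())
  split-by-valuations lit (q ∷ ps) {a} {t} covered below-t =
    ≤-trans (≤-⊔-split (covered (here refl))) (∨-least (branch true) (branch false))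
    where
      update-lits : ∀ {x v b} → x ≤ lit q b → (∀ {p} → p ∈ ps → x ≤ lit p (v p)) →
                    ∀ {p} → p ∈ q ∷ ps → x ≤ lit p ((v [ q ≔ b ]) p)
      update-lits x≤q x≤ps {p} p∈ with p ≟ q
      ... | yes refl = x≤q
      ... | no p≢q   = x≤ps (tail p≢q p∈)

      branch : ∀ b → a ⊓ lit q b ≤ t
      branch b = split-by-valuations lit ps
        (λ p∈ → ≤-trans (x∧y≤x a (lit q b)) (covered (there p∈)))
        (λ v x≤ x≤ps → below-t (v [ q ≔ b ]) (≤-trans x≤ (x∧y≤x a (lit q b)))
                                 (update-lits (≤-trans x≤ (x∧y≤y a (lit q b))) x≤ps))

  module _ {h : Fm → Carrier} (hom : IsHom h) where
    open IsHom hom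

    ⊩-evalB : ∀ {x v φ} → IsCPL φ → (∀ {p} → p ∈ vars φ → x ⊩ signed (v p) (h (var p))) →
              x ⊩ signed (evalB v φ) (h φ)
    ⊩-evalB (var n) atoms = atoms (here refl)
    ⊩-evalB {v = v} (and {a} {b} ca cb) atoms rewrite hom-∧ a b =
      ⊩-signed-∧ (evalB v a) (evalB v b)
        (⊩-evalB ca (λ p∈ → atoms (∈-++⁺ˡ p∈))) (⊩-evalB cb (λ p∈ → atoms (∈-++⁺ʳ (vars a) p∈)))
    ⊩-evalB {v = v} (or {a} {b} ca cb) atoms rewrite hom-∨ a b =
      ⊩-signed-∨ (evalB v a) (evalB v b)
        (⊩-evalB ca (λ p∈ → atoms (∈-++⁺ˡ p∈))) (⊩-evalB cb (λ p∈ → atoms (∈-++⁺ʳ (vars a) p∈)))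
    ⊩-evalB {v = v} (neg {a} ca) atoms rewrite hom-¬ a =
      ⊩-signed-not (evalB v a) (⊩-evalB ca atoms)

    premises-hold-or-≡𝟘 : ∀ {x v} Γ → All IsCPL Γ → All (λ γ → x ≤ h γ) Γ →
      (∀ {p} → p ∈ varsList Γ → x ⊩ signed (v p) (h (var p))) →
      All (λ γ → evalB v γ ≡ true) Γ ⊎ x ≡ 𝟘
    premises-hold-or-≡𝟘 [] [] [] _ = inj₁ []
    premises-hold-or-≡𝟘 {v = v} (γ ∷ Γ) (cγ ∷ cΓ) (x≤γ ∷ x≤Γ) atoms
      with ⊩-signed-≤ (evalB v γ) (⊩-evalB cγ (λ p∈ → atoms (∈-++⁺ˡ p∈))) x≤γ
    ... | inj₂ x≡𝟘 = inj₂ x≡𝟘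
    ... | inj₁ γ-true =
      Sum.map₁ (γ-true ∷_) (premises-hold-or-≡𝟘 Γ cΓ x≤Γ (λ p∈ → atoms (∈-++⁺ʳ (vars γ) p∈)))

    hom-Δ : ∀ φ → h (¬f (∇f (¬f φ))) ≡ Δ (h φ)
    hom-Δ φ = trans (hom-¬ _) (cong ~_ (trans (hom-∇ _) (cong ∇_ (hom-¬ φ))))

    hom-∘ : ∀ φ → h (∘ φ) ≡ Δ (h φ) ⊔ Δ (~ h φ)
    hom-∘ φ = trans (hom-∨ _ _) (cong₂ _⊔_ (hom-Δ φ) (trans (hom-Δ (¬f φ)) (cong Δ (hom-¬ φ))))

    ⊢CPL⇒≤ : ∀ {Γ α a} → All IsCPL Γ → IsCPL α → Γ ⊢CPL α → All (λ γ → a ≤ h γ) Γ →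
             (∀ {p} → p ∈ varsList (α ∷ Γ) → a ≤ h (∘ var p)) → a ≤ h α
    ⊢CPL⇒≤ {Γ} {α} {a} cΓ cα Γ⊢α a≤Γ a≤∘ =
      split-by-valuations lit (varsList (α ∷ Γ)) (λ p∈ → subst (a ≤_) (hom-∘ _) (a≤∘ p∈)) below-α
      where
        lit : ℕ → Bool → Carrier
        lit p b = Δ (signed b (h (var p)))

        below-α : ∀ {x} v → x ≤ a → (∀ {p} → p ∈ varsList (α ∷ Γ) → x ≤ lit p (v p)) → x ≤ h α
        below-α {x} v x≤a x≤lits =
          Sum.[ (λ Γ-true → ⊩-signed-true (Γ⊢α v Γ-true) (⊩-evalB cα (λ p∈ → atom (∈-++⁺ˡ p∈)))) , ≡𝟘⇒≤ ]
            (premises-hold-or-≡𝟘 Γ cΓ (All.map (≤-trans x≤a) a≤Γ) (λ p∈ → atom (∈-++⁺ʳ (vars α) p∈)))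
          where
            atom : ∀ {p} → p ∈ varsList (α ∷ Γ) → x ⊩ signed (v p) (h (var p))
            atom p∈ = ⊩-antitone (x≤lits p∈) (Δ-⊩ _)

boolInvStoneAlgebra : InvStoneAlgebra
boolInvStoneAlgebra = record
  { Carrier   = Bool
  ; _⊓_       = _∧ᵇ_
  ; _⊔_       = _∨ᵇ_
  ; ~_        = not
  ; ∇_        = λ b → b
  ; 𝟘         = false
  ; 𝟙         = true
  ; ⊓-assoc   = Bool.∧-assoc
  ; ⊔-assoc   = Bool.∨-assoc
  ; ⊓-comm    = Bool.∧-comm
  ; ⊔-comm    = Bool.∨-comm
  ; ⊓-absorb  = Bool.∧-abs-∨
  ; ⊔-absorb  = Bool.∨-abs-∧
  ; ⊓-distrib = Bool.∧-distribˡ-∨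
  ; ⊓-𝟙       = Bool.∧-identityʳ
  ; ⊔-𝟘       = Bool.∨-identityʳ
  ; ~~        = Bool.not-involutive
  ; ~-⊓       = λ { true _ → refl ; false _ → refl }
  ; ∇𝟘        = refl
  ; ∇-incr    = Bool.∧-idem
  ; ∇-⊓       = λ _ _ → refl
  ; ∇-compl   = Bool.∧-inverseˡ
  }

evalB-isHom : ∀ v → InvStoneAlgebra.IsHom boolInvStoneAlgebra (evalB v)
evalB-isHom v = record
  { hom-∧ = λ _ _ → refl
  ; hom-∨ = λ _ _ → refl
  ; hom-¬ = λ _ → refl
  ; hom-∇ = λ _ → refl
  ; hom-⊥ = refl
  ; hom-⊤ = refl
  }

evalB-∘ : ∀ v φ → evalB v (∘ φ) ≡ true
evalB-∘ v φ with evalB v φ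
... | true  = refl
... | false = refl

mainTheorem7 : (Γ : List Fm) (α : Fm) → All IsCPL Γ → IsCPL α →
    ((Γ ⊢CPL α → Γ ++ map (λ n → ∘ (var n)) (varsList (α ∷ Γ)) ⊨Six α)
    × (Γ ++ map (λ n → ∘ (var n)) (varsList (α ∷ Γ)) ⊨Six α → Γ ⊢CPL α))
mainTheorem7 Γ α cΓ cα = sound , complete
  where
    sound : Γ ⊢CPL α → Γ ++ map (λ n → ∘ (var n)) (varsList (α ∷ Γ)) ⊨Six α
    sound Γ⊢α A h hom a a≤premises =
      sym (⊢CPL⇒≤ hom cΓ cα Γ⊢α (All.map sym (++⁻ˡ Γ a≤premises))
                               (λ p∈ → sym (All.lookup (map⁻ (++⁻ʳ Γ a≤premises)) p∈)))
      where open InvStoneAlgebraProperties A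

    -- At a = true the order condition true ∧ b ≡ true is definitionally b ≡ true.
    complete : Γ ++ map (λ n → ∘ (var n)) (varsList (α ∷ Γ)) ⊨Six α → Γ ⊢CPL α
    complete Γ⊨α v Γ-true =
      Γ⊨α boolInvStoneAlgebra (evalB v) (evalB-isHom v) true
          (++⁺ Γ-true (map⁺ (All.universal (λ n → evalB-∘ v (var n)) (varsList (α ∷ Γ)))))
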